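{- Let $G$ be a graph of order $n\ge 2$ and maximum degree $\Delta(G)=n-2$. Then $\mathcal{A}(G)\le \frac{n^2-n+1}{n}$, with equality if and only if $G$ is isomorphic to $K_{n-1}\cup K_1$ (the disjoint union of a complete graph on $n-1$ vertices and an isolated vertex).
   Context: Graphs are finite and simple. For a graph $G$ of order $n$ and an integer $k$, $S(G,k)$ denotes the number of partitions of $V(G)$ into exactly $k$ nonempty stable sets (non-equivalent colorings with exactly $k$ colors). Let $\mathcal{B}(G)=\sum_{k=1}^n S(G,k)$, $\mathcal{T}(G)=\sum_{k=1}^n kS(G,k)$, and $\mathcal{A}(G)=\mathcal{T}(G)/\mathcal{B}(G)$. $G\cup H$ denotes the disjoint union of graphs. -}

module Defs where

open import Data.Bool using (Bool; true; false; _∧_; _∨_; not; if_then_else_)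
open import Data.Nat using (ℕ; zero; suc; _+_; _*_; _∸_; _⊔_; _!; _/_)
open import Data.Nat.Properties using (_!≢0)
open import Data.Integer using (+_)
open import Data.Rational using (ℚ; 0ℚ) renaming (_/_ to _/ℚ_)
open import Data.Fin using (Fin; toℕ; splitAt; _≟_)
open import Data.Fin.Base using (cast)
open import Data.List using (List; []; _∷_; map; concatMap; length; filter; foldr)
open import Data.Bool.ListAction using (all; any)
open import Data.List.Base using (allFin)
open import Data.Vec using (Vec; lookup) renaming ([] to []ᵥ; _∷_ to _∷ᵥ_)
open import Data.Sum using (inj₁; inj₂)
open import Relation.Nullary.Decidable using (⌊_⌋)
open import Relation.Binary.PropositionalEquality using (_≡_)
open import Function.Bundles using (_⤖_; Bijection)

record Graph (n : ℕ) : Set where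
  field
    adj    : Fin n → Fin n → Bool
    adj-sym    : ∀ i j → adj i j ≡ adj j i
    adj-irrefl : ∀ i → adj i i ≡ false
open Graph public

degree : ∀ {n} → Graph n → Fin n → ℕ
degree G v = length (filter (λ u → adj G v u Data.Bool.≟ true) (allFin _))

maxDegree : ∀ {n} → Graph n → ℕ
maxDegree G = foldr _⊔_ 0 (map (degree G) (allFin _))

allVecs : (k n : ℕ) → List (Vec (Fin k) n)
allVecs k zero    = []ᵥ ∷ []
allVecs k (suc n) = concatMap (λ c → map (c ∷ᵥ_) (allVecs k n)) (allFin k)

isProper : ∀ {n k} → Graph n → Vec (Fin k) n → Bool
isProper G c = all (λ i → all (λ j → not (adj G i j) ∨ not ⌊ lookup c i ≟ lookup c j ⌋) (allFin _)) (allFin _)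

isSurjective : ∀ {n k} → Vec (Fin k) n → Bool
isSurjective c = all (λ a → any (λ i → ⌊ lookup c i ≟ a ⌋) (allFin _)) (allFin _)

surjProper : ∀ {n} → Graph n → ℕ → ℕ
surjProper {n} G k =
  length (filter (λ c → (isProper G c ∧ isSurjective c) Data.Bool.≟ true) (allVecs k n))

-- S(G,k): number of partitions of V(G) into exactly k nonempty stable sets
-- = number of non-equivalent colourings with exactly k colours
-- = (proper surjective colourings Fin n → Fin k) / k!  (S_k acts freely on them)
S : ∀ {n} → Graph n → ℕ → ℕ
S G k = (surjProper G k / k !) {{k !≢0}}

sumFrom1 : ℕ → (ℕ → ℕ) → ℕ
sumFrom1 zero    f = 0
sumFrom1 (suc n) f = sumFrom1 n f + f (suc n)

𝓑 : ∀ {n} → Graph n → ℕ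
𝓑 {n} G = sumFrom1 n (S G)

𝓣 : ∀ {n} → Graph n → ℕ
𝓣 {n} G = sumFrom1 n (λ k → k * S G k)

-- a / b as a rational (b = 0 never occurs for 𝓑 of a graph with n ≥ 1)
divℚ : ℕ → ℕ → ℚ
divℚ a zero    = 0ℚ
divℚ a (suc b) = (+ a) /ℚ (suc b)

𝓐 : ∀ {n} → Graph n → ℚ
𝓐 G = divℚ (𝓣 G) (𝓑 G)

record _≅_ {m n : ℕ} (G : Graph m) (H : Graph n) : Set where
  field
    bij      : Fin m ⤖ Fin n
    preserve : ∀ i j → adj H (Bijection.to bij i) (Bijection.to bij j) ≡ adj G i j

complete : (m : ℕ) → Graph m
complete m = record { adj = λ i j → not ⌊ i ≟ j ⌋ ; adj-sym = s ; adj-irrefl = r }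
  where
  open import Relation.Nullary using (yes; no)
  open import Relation.Binary.PropositionalEquality using (refl; sym)
  s : ∀ i j → not ⌊ i ≟ j ⌋ ≡ not ⌊ j ≟ i ⌋
  s i j with i ≟ j | j ≟ i
  ... | yes _ | yes _ = refl
  ... | no _  | no _  = refl
  ... | yes p | no q  = Data.Empty.⊥-elim (q (sym p)) where import Data.Empty
  ... | no p  | yes q = Data.Empty.⊥-elim (p (sym q)) where import Data.Empty
  r : ∀ i → not ⌊ i ≟ i ⌋ ≡ false
  r i with i ≟ i
  ... | yes _ = refl
  ... | no p  = Data.Empty.⊥-elim (p refl) where import Data.Empty

_∪_ : ∀ {m p} → Graph m → Graph p → Graph (m + p)
_∪_ {m} {p} G H = record { adj = a ; adj-sym = s ; adj-irrefl = r }
  where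
  open Relation.Binary.PropositionalEquality using (refl)
  a : Fin (m + p) → Fin (m + p) → Bool
  a i j with splitAt m i | splitAt m j
  ... | inj₁ x | inj₁ y = adj G x y
  ... | inj₂ x | inj₂ y = adj H x y
  ... | inj₁ _ | inj₂ _ = false
  ... | inj₂ _ | inj₁ _ = false
  s : ∀ i j → a i j ≡ a j i
  s i j with splitAt m i | splitAt m j
  ... | inj₁ x | inj₁ y = adj-sym G x y
  ... | inj₂ x | inj₂ y = adj-sym H x y
  ... | inj₁ _ | inj₂ _ = refl
  ... | inj₂ _ | inj₁ _ = refl
  r : ∀ i → a i i ≡ false
  r i with splitAt m i
  ... | inj₁ x = adj-irrefl G x
  ... | inj₂ x = adj-irrefl H x

{-# OPTIONS --safe #-}
module Submission where

-- Write n = m + 2.  Every graph on n vertices has exactly one partition into n stable sets,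
-- so S(G,n) = 1; with B = Σ_{k≤m} S(G,k), T = Σ_{k≤m} k·S(G,k) ≤ m·B and s = S(G,m+1) this
-- gives 𝓑 = B + s + 1 and 𝓣 = T + (m+1)s + n, and clearing denominators shows
-- 𝓐 < (n²-n+1)/n as soon as B ≥ 1, e.g. when V(G) splits into m stable sets.  Since
-- Δ(G) = n - 2, every vertex has a non-neighbour.  Two disjoint non-edges, or a stable triple,
-- yield a partition into m stable sets; if there are neither, the non-edges form a spanning
-- star, i.e. G ≅ K_{n-1} ∪ K_1, where S(G,k) = 0 for k ≤ m and S(G,m+1) = m+1 give equality.

open import Defs

module StableSetPartitions where

  open import Data.Bool as Bool using (Bool; true; false; not; _∧_; _∨_)
  open import Data.Bool.Properties using (T-≡; not-¬; ∧-conicalˡ; ∧-conicalʳ)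
  open import Data.Bool.ListAction using (all; any)
  open import Data.Nat using (ℕ; zero; suc; _+_; _*_; _∸_; _≤_; _<_; _⊔_; _!; _/_; s≤s; z≤n; _≤?_)
  open import Data.Nat.Properties
    using ( ≤-refl; ≤-trans; ≤-antisym; <-irrefl; ≤-<-trans; <⇒≱; n<1+n; n≤1+n; m≤n⇒m≤1+n
          ; m≤m+n; m≤n+m; m<m+n; m≤m⊔n; m≤n⊔m; +-comm; +-monoˡ-≤; *-monoˡ-≤; *-distribˡ-+
          ; *-identityˡ; *-zeroʳ; m+n∸m≡n; _!≢0; module ≤-Reasoning)
  open import Data.Nat.DivMod using (m*n/n≡m; m≥n⇒m/n>0)
  open import Data.Nat.Tactic.RingSolver using (solve-∀)
  import Data.Integer as ℤ
  open import Data.Integer.Properties using (pos-*)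
  import Data.Rational as ℚ
  import Data.Rational.Properties as ℚ
  open import Data.Rational.Unnormalised using (mkℚᵘ; *<*)
  open import Data.Rational.Unnormalised.Properties using (<-respˡ-≃; <-respʳ-≃; ≃-sym)
  open import Data.Fin as Fin using (Fin; punchIn; punchOut; splitAt; _↑ˡ_; _↑ʳ_)
  open import Data.Fin.Properties
    using ( any?; injective⇒≤; <⇒notInjective; 0≢1+n; suc-injective; punchOut-injective; punchOut-cong
          ; punchOut-punchIn; punchIn-injective; punchInᵢ≢i; splitAt-↑ʳ; splitAt⁻¹-↑ˡ; splitAt⁻¹-↑ʳ)
  open import Data.Fin.Permutation using (Permutation′; _⟨$⟩ʳ_; transpose; cast-id; _∘ₚ_)
  open import Data.List as List using (List; []; _∷_; _++_; foldr; length; filter; map; allFin; cartesianProductWith)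
  open import Data.List.Properties using (filter-++; filter-none; length-++; length-map; length-tabulate)
  open import Data.List.Membership.Propositional using (_∈_)
  open import Data.List.Membership.Propositional.Properties
    using (∈-allFin; ∈-lookup; ∈-map⁺; ∈-map⁻; ∈-filter⁺; ∈-filter⁻; ∈-cartesianProductWith⁺)
  open import Data.List.Relation.Unary.All as All using (All)
  import Data.List.Relation.Unary.All.Properties as All
  open import Data.List.Relation.Unary.Any as Any using (here; there)
  import Data.List.Relation.Unary.Any.Properties as Any
  import Data.List.Relation.Unary.AllPairs as AllPairs
  open import Data.List.Relation.Unary.Unique.Propositional using (Unique)
  import Data.List.Relation.Unary.Unique.Propositional.Properties as Unique
  open import Data.Vec using (Vec; lookup; tabulate) renaming ([] to []ᵥ; _∷_ to _∷ᵥ_)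
  open import Data.Vec.Properties using (∷-injective; lookup∘tabulate; tabulate∘lookup; tabulate-cong)
  open import Data.Product as Product using (Σ; ∃; ∃-syntax; _×_; _,_; proj₁; proj₂; swap)
  open import Data.Sum as Sum using (_⊎_; inj₁; inj₂)
  open import Function using (_∘_; id; _⇔_; mk⇔; Equivalence; _⤖_; Bijection)
  open import Function.Construct.Composition using (_⇔-∘_)
  open import Function.Construct.Symmetry using (⇔-sym)
  open import Function.Definitions using (Injective; StrictlySurjective)
  open import Function.Properties.Inverse using (↔⇒⤖)
  open import Relation.Binary.PropositionalEquality
  open import Relation.Nullary using (¬_; Dec; yes; no; does; contradiction)
  open import Relation.Nullary.Decidable using (⌊_⌋; toWitness; fromWitness; decidable-stable; dec-true; _×-dec_; ¬?)
  open import Relation.Unary using (Decidable)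

  private
    variable
      k m n : ℕ

  module _ {A B : Set} where

    Unique⇒lookup-injective : {xs : List A} → Unique xs → Injective _≡_ _≡_ (List.lookup xs)
    Unique⇒lookup-injective (_  AllPairs.∷ u) {Fin.zero}  {Fin.zero}  _ = refl
    Unique⇒lookup-injective (x∉ AllPairs.∷ u) {Fin.zero}  {Fin.suc j} e =
      contradiction e (All.lookup x∉ (∈-lookup j))
    Unique⇒lookup-injective (x∉ AllPairs.∷ u) {Fin.suc i} {Fin.zero}  e =
      contradiction (sym e) (All.lookup x∉ (∈-lookup i))
    Unique⇒lookup-injective (_  AllPairs.∷ u) {Fin.suc i} {Fin.suc j} e = cong Fin.suc (Unique⇒lookup-injective u e)

    length-≤-injection : {xs : List A} {ys : List B} → Unique xs →
      (f : ∀ {x} → x ∈ xs → B) → (∀ {x} (x∈ : x ∈ xs) → f x∈ ∈ ys) →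
      (∀ {x y} (x∈ : x ∈ xs) (y∈ : y ∈ xs) → f x∈ ≡ f y∈ → x ≡ y) →
      length xs ≤ length ys
    length-≤-injection {xs} {ys} uniq f f∈ f-inj = injective⇒≤ index-injective
      where
      index : Fin (length xs) → Fin (length ys)
      index i = Any.index (f∈ (∈-lookup i))
      index-injective : Injective _≡_ _≡_ index
      index-injective {i} {j} e = Unique⇒lookup-injective uniq (f-inj (∈-lookup i) (∈-lookup j) (begin
        f (∈-lookup i)            ≡⟨ Any.lookup-index (f∈ (∈-lookup i)) ⟩
        List.lookup ys (index i)  ≡⟨ cong (List.lookup ys) e ⟩
        List.lookup ys (index j)  ≡⟨ Any.lookup-index (f∈ (∈-lookup j)) ⟨
        f (∈-lookup j)            ∎))
        where open ≡-Reasoning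

    length-filter-map : ∀ {p} {P : B → Set p} (P? : Decidable P) (f : A → B) xs →
      length (filter P? (map f xs)) ≡ length (filter (P? ∘ f) xs)
    length-filter-map P? f []       = refl
    length-filter-map P? f (x ∷ xs) with does (P? (f x))
    ... | true  = cong suc (length-filter-map P? f xs)
    ... | false = length-filter-map P? f xs

  concatMap-map≡cartesianProductWith : {A B C : Set} (f : A → B → C) (xs : List A) (ys : List B) →
    List.concatMap (λ x → map (f x) ys) xs ≡ cartesianProductWith f xs ys
  concatMap-map≡cartesianProductWith f []       ys = refl
  concatMap-map≡cartesianProductWith f (x ∷ xs) ys =
    cong (map (f x) ys ++_) (concatMap-map≡cartesianProductWith f xs ys)

  strictlySurjective-∘ : {A B C : Set} {f : A → B} {g : B → C} →
    StrictlySurjective _≡_ f → StrictlySurjective _≡_ g → StrictlySurjective _≡_ (g ∘ f)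
  strictlySurjective-∘ f-surj g-surj z with y , refl ← g-surj z with x , refl ← f-surj y = x , refl

  injective⇒strictlySurjective : {f : Fin n → Fin n} → Injective _≡_ _≡_ f → StrictlySurjective _≡_ f
  injective⇒strictlySurjective {suc n} {f} f-inj a with any? (λ i → f i Fin.≟ a)
  ... | yes hit  = hit
  ... | no  miss = contradiction (λ {i} {j} → avoid-injective {i} {j}) (<⇒notInjective (n<1+n n))
    where
    missed : ∀ i → a ≢ f i
    missed i a≡fi = miss (i , sym a≡fi)
    avoid-injective : Injective _≡_ _≡_ (λ i → punchOut (missed i))
    avoid-injective {i} {j} = f-inj ∘ punchOut-injective (missed i) (missed j)

  strictlySurjective⇒injective : {f : Fin n → Fin n} → StrictlySurjective _≡_ f → Injective _≡_ _≡_ f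
  strictlySurjective⇒injective {f = f} f-surj {i} {j} fi≡fj = begin
    i              ≡⟨ section∘f i ⟨
    section (f i)  ≡⟨ cong section fi≡fj ⟩
    section (f j)  ≡⟨ section∘f j ⟩
    j              ∎
    where
    open ≡-Reasoning
    section = proj₁ ∘ f-surj
    f∘section : ∀ a → f (section a) ≡ a
    f∘section = proj₂ ∘ f-surj
    section∘f : ∀ i → section (f i) ≡ i
    section∘f i with i′ , refl ← injective⇒strictlySurjective
      (λ {a} {b} e → trans (sym (f∘section a)) (trans (cong f e) (f∘section b))) i
      = cong section (f∘section i′)

  tabulate-≡⇒≗ : {A : Set} {f g : Fin n → A} → tabulate f ≡ tabulate g → f ≗ g
  tabulate-≡⇒≗ {f = f} {g} eq i = begin
    f i                    ≡⟨ lookup∘tabulate f i ⟨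
    lookup (tabulate f) i  ≡⟨ cong (λ v → lookup v i) eq ⟩
    lookup (tabulate g) i  ≡⟨ lookup∘tabulate g i ⟩
    g i                    ∎
    where open ≡-Reasoning

  lookup-≗⇒≡ : {A : Set} {u v : Vec A n} → lookup u ≗ lookup v → u ≡ v
  lookup-≗⇒≡ {u = u} {v} eq = trans (sym (tabulate∘lookup u)) (trans (tabulate-cong eq) (tabulate∘lookup v))

  injective-tabulate : {h : Fin n → Fin k} → Injective _≡_ _≡_ h → Injective _≡_ _≡_ (lookup (tabulate h))
  injective-tabulate {h = h} h-inj {i} {j} e =
    h-inj (trans (sym (lookup∘tabulate h i)) (trans e (lookup∘tabulate h j)))

  module _ {a : Fin k} {w : Vec (Fin k) n} where

    injective-∷⁻ : Injective _≡_ _≡_ (lookup (a ∷ᵥ w)) →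
      (∀ i → a ≢ lookup w i) × Injective _≡_ _≡_ (lookup w)
    injective-∷⁻ inj = (λ i → 0≢1+n ∘ inj) , (suc-injective ∘ inj)

    injective-∷⁺ : (∀ i → a ≢ lookup w i) → Injective _≡_ _≡_ (lookup w) →
      Injective _≡_ _≡_ (lookup (a ∷ᵥ w))
    injective-∷⁺ a∉w w-inj {Fin.zero}  {Fin.zero}  _ = refl
    injective-∷⁺ a∉w w-inj {Fin.zero}  {Fin.suc j} e = contradiction e (a∉w j)
    injective-∷⁺ a∉w w-inj {Fin.suc i} {Fin.zero}  e = contradiction (sym e) (a∉w i)
    injective-∷⁺ a∉w w-inj {Fin.suc i} {Fin.suc j} e = cong Fin.suc (w-inj e)

  -- Counting words

  allVecs-suc : ∀ k n → allVecs k (suc n) ≡ cartesianProductWith _∷ᵥ_ (allFin k) (allVecs k n)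
  allVecs-suc k n = concatMap-map≡cartesianProductWith _∷ᵥ_ (allFin k) (allVecs k n)

  ∈-allVecs : (c : Vec (Fin k) n) → c ∈ allVecs k n
  ∈-allVecs []ᵥ = here refl
  ∈-allVecs {k} {suc n} (a ∷ᵥ c) rewrite allVecs-suc k n =
    ∈-cartesianProductWith⁺ _∷ᵥ_ (∈-allFin a) (∈-allVecs c)

  allVecs-unique : ∀ k n → Unique (allVecs k n)
  allVecs-unique k zero    = All.[] AllPairs.∷ AllPairs.[]
  allVecs-unique k (suc n) rewrite allVecs-suc k n =
    Unique.cartesianProductWith⁺ _∷ᵥ_ ∷-injective (Unique.allFin⁺ k) (allVecs-unique k n)

  -- surjProper G k is by definition count (λ c → isProper G c ∧ isSurjective c).
  count : (Vec (Fin k) n → Bool) → ℕ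
  count {k} {n} P = length (filter (λ c → P c Bool.≟ true) (allVecs k n))

  module _ {k n k′ n′} {P : Vec (Fin k) n → Bool} {Q : Vec (Fin k′) n′ → Bool} where

    count-≤-injection : (f : ∀ c → P c ≡ true → Vec (Fin k′) n′) →
      (∀ c p → Q (f c p) ≡ true) → (∀ {c d} p q → f c p ≡ f d q → c ≡ d) →
      count P ≤ count Q
    count-≤-injection f f-Q f-inj = length-≤-injection
      (Unique.filter⁺ P? (allVecs-unique k n))
      (λ {c} c∈ → f c (satisfies c∈))
      (λ c∈ → ∈-filter⁺ Q? (∈-allVecs _) (f-Q _ (satisfies c∈)))
      (λ c∈ d∈ → f-inj (satisfies c∈) (satisfies d∈))
      where
      P? = λ c → P c Bool.≟ true
      Q? = λ c → Q c Bool.≟ true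
      satisfies : ∀ {c} → c ∈ filter P? (allVecs k n) → P c ≡ true
      satisfies = proj₂ ∘ ∈-filter⁻ P? {xs = allVecs k n}

    count-≤-tabulate : (h : ∀ c → P c ≡ true → Fin n′ → Fin k′) →
      (∀ c p → Q (tabulate (h c p)) ≡ true) → (∀ {c d} p q → h c p ≗ h d q → c ≡ d) →
      count P ≤ count Q
    count-≤-tabulate h h-Q h-inj =
      count-≤-injection (λ c p → tabulate (h c p)) h-Q (λ p q → h-inj p q ∘ tabulate-≡⇒≗)

  module _ {k n} {P Q : Vec (Fin k) n → Bool} where

    count-cong : (∀ c → P c ≡ true ⇔ Q c ≡ true) → count P ≡ count Q
    count-cong P⇔Q = ≤-antisym
      (count-≤-injection (λ c _ → c) (λ c → Equivalence.to (P⇔Q c)) (λ _ _ → id))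
      (count-≤-injection (λ c _ → c) (λ c → Equivalence.from (P⇔Q c)) (λ _ _ → id))

  count-none : {P : Vec (Fin k) n → Bool} → (∀ c → P c ≢ true) → count P ≡ 0
  count-none {k} {n} {P} ¬P =
    cong length (filter-none (λ c → P c Bool.≟ true) {xs = allVecs k n} (All.tabulate (λ {c} _ → ¬P c)))

  count-cons : {P : Vec (Fin k) (suc n) → Bool} (r : ℕ) →
    (∀ a → count (λ w → P (a ∷ᵥ w)) ≡ r) → count P ≡ k * r
  count-cons {k} {n} {P} r fibre rewrite allVecs-suc k n =
    trans (by-heads (allFin k)) (cong (_* r) (length-tabulate {n = k} id))
    where
    open ≡-Reasoning
    P? = λ c → P c Bool.≟ true
    by-heads : ∀ as → length (filter P? (cartesianProductWith _∷ᵥ_ as (allVecs k n))) ≡ length as * r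
    by-heads []       = refl
    by-heads (a ∷ as) = begin
      length (filter P? (heads ++ rest))                  ≡⟨ cong length (filter-++ P? heads rest) ⟩
      length (filter P? heads ++ filter P? rest)          ≡⟨ length-++ (filter P? heads) ⟩
      length (filter P? heads) + length (filter P? rest)
        ≡⟨ cong₂ _+_ (trans (length-filter-map P? (a ∷ᵥ_) (allVecs k n)) (fibre a)) (by-heads as) ⟩
      r + length as * r                                   ∎
      where
      heads = map (a ∷ᵥ_) (allVecs k n)
      rest  = cartesianProductWith _∷ᵥ_ as (allVecs k n)

  -- Colourings

  module _ (p : Fin n → Bool) where

    T-all-allFin : Bool.T (all p (allFin n)) ⇔ (∀ i → Bool.T (p i))
    T-all-allFin = mk⇔ (All.tabulate⁻ ∘ All.all⁺ p (allFin n)) (All.all⁻ p ∘ All.tabulate⁺)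

    T-any-allFin : Bool.T (any p (allFin n)) ⇔ (∃ λ i → Bool.T (p i))
    T-any-allFin = mk⇔ (Any.tabulate⁻ ∘ Any.any⁻ p (allFin n)) (λ (i , pi) → Any.any⁺ p (Any.tabulate⁺ i pi))

  T-not∨not : ∀ {A : Set} b (a? : Dec A) → Bool.T (not b ∨ not ⌊ a? ⌋) ⇔ (b ≡ true → ¬ A)
  T-not∨not false a?      = mk⇔ (λ _ ()) _
  T-not∨not true  (yes a) = mk⇔ (λ ()) (λ ¬a → ¬a refl a)
  T-not∨not true  (no ¬a) = mk⇔ (λ _ _ → ¬a) _

  isSurjective⇔ : (c : Vec (Fin k) n) → isSurjective c ≡ true ⇔ StrictlySurjective _≡_ (lookup c)
  isSurjective⇔ c = mk⇔
    (λ e a → Product.map₂ toWitness (to (T-any-allFin _) (to (T-all-allFin _) (from T-≡ e) a)))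
    (λ surj → to T-≡ (from (T-all-allFin _) (λ a → from (T-any-allFin _) (Product.map₂ fromWitness (surj a)))))
    where open Equivalence

  Proper : Graph n → Vec (Fin k) n → Set
  Proper G c = ∀ i j → adj G i j ≡ true → lookup c i ≢ lookup c j

  proper-tabulate : (G : Graph n) {f : Fin n → Fin k} →
    (∀ i j → adj G i j ≡ true → f i ≢ f j) → Proper G (tabulate f)
  proper-tabulate G {f} f-proper i j i~j eq =
    f-proper i j i~j (trans (sym (lookup∘tabulate f i)) (trans eq (lookup∘tabulate f j)))

  strictlySurjective-tabulate : {f : Fin n → Fin k} →
    StrictlySurjective _≡_ f → StrictlySurjective _≡_ (lookup (tabulate f))
  strictlySurjective-tabulate {f = f} f-surj a with x , fx≡a ← f-surj a = x , trans (lookup∘tabulate f x) fx≡a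

  isProper⇔ : (G : Graph n) (c : Vec (Fin k) n) → isProper G c ≡ true ⇔ Proper G c
  isProper⇔ G c = mk⇔
    (λ e i j → to (T-not∨not _ _) (to (T-all-allFin _) (to (T-all-allFin _) (from T-≡ e) i) j))
    (λ proper → to T-≡ (from (T-all-allFin _) (λ i →
      from (T-all-allFin _) (λ j → from (T-not∨not _ _) (proper i j)))))
    where open Equivalence

  ExactColouring : Graph n → Vec (Fin k) n → Set
  ExactColouring G c = Proper G c × StrictlySurjective _≡_ (lookup c)

  isExactColouring⇔ : (G : Graph n) (c : Vec (Fin k) n) →
    (isProper G c ∧ isSurjective c) ≡ true ⇔ ExactColouring G c
  isExactColouring⇔ G c = mk⇔
    (λ e → to (isProper⇔ G c) (∧-conicalˡ _ _ e) , to (isSurjective⇔ c) (∧-conicalʳ _ _ e))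
    (λ (proper , surj) → cong₂ _∧_ (from (isProper⇔ G c) proper) (from (isSurjective⇔ c) surj))
    where open Equivalence

  adj-complete : {i j : Fin n} → i ≢ j → adj (complete n) i j ≡ true
  adj-complete {i = i} {j} i≢j with i Fin.≟ j
  ... | yes i≡j = contradiction i≡j i≢j
  ... | no  _   = refl

  injective⇒proper : (G : Graph n) {c : Vec (Fin k) n} → Injective _≡_ _≡_ (lookup c) → Proper G c
  injective⇒proper G c-inj i j i~j ci≡cj with refl ← c-inj ci≡cj = not-¬ (adj-irrefl G i) i~j

  -- A colouring of the complete graph is proper exactly when it is injective.
  isInjective : Vec (Fin k) n → Bool
  isInjective = isProper (complete _)

  isInjective⇔ : (c : Vec (Fin k) n) → isInjective c ≡ true ⇔ Injective _≡_ _≡_ (lookup c)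
  isInjective⇔ {n = n} c = mk⇔
    (λ e {i} {j} ci≡cj → decidable-stable (i Fin.≟ j)
      (λ i≢j → to (isProper⇔ (complete n) c) e i j (adj-complete i≢j) ci≡cj))
    (from (isProper⇔ (complete n) c) ∘ injective⇒proper (complete n) {c})
    where open Equivalence

  -- Deleting the letter a from the alphabet (punchOut) is a bijection from the injective words
  -- a ∷ w onto the injective words over the smaller alphabet; punchIn a is its inverse.
  count-isInjective-∷ : (a : Fin (suc k)) →
    count {suc k} {n} (λ w → isInjective (a ∷ᵥ w)) ≡ count {k} {n} isInjective
  count-isInjective-∷ {k} {n} a = ≤-antisym
    (count-≤-tabulate {P = λ w → isInjective (a ∷ᵥ w)} {Q = isInjective} remove
      (λ w p → from (isInjective⇔ (tabulate (remove w p))) (injective-tabulate (remove-injective p)))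
      (λ p q eq → lookup-≗⇒≡ (λ i → punchOut-injective (a∉ p i) (a∉ q i) (eq i))))
    (count-≤-tabulate {P = isInjective} {Q = λ w → isInjective (a ∷ᵥ w)} insert
      (λ w p → from (isInjective⇔ (a ∷ᵥ tabulate (insert w p))) (injective-∷⁺
        (λ i a≡ → punchInᵢ≢i a (lookup w i) (sym (trans a≡ (lookup∘tabulate (insert w p) i))))
        (injective-tabulate (to (isInjective⇔ w) p ∘ punchIn-injective a _ _))))
      (λ _ _ eq → lookup-≗⇒≡ (λ i → punchIn-injective a _ _ (eq i))))
    where
    open Equivalence
    module _ {w : Vec (Fin (suc k)) n} (p : isInjective (a ∷ᵥ w) ≡ true) where
      a∉ : ∀ i → a ≢ lookup w i
      a∉ = proj₁ (injective-∷⁻ (to (isInjective⇔ (a ∷ᵥ w)) p))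
      remove-injective : Injective _≡_ _≡_ (λ i → punchOut (a∉ i))
      remove-injective {i} {j} =
        proj₂ (injective-∷⁻ (to (isInjective⇔ (a ∷ᵥ w)) p)) ∘ punchOut-injective (a∉ i) (a∉ j)
    remove : ∀ w → isInjective (a ∷ᵥ w) ≡ true → Fin n → Fin k
    remove w p i = punchOut (a∉ p i)
    insert : ∀ (w : Vec (Fin k) n) → isInjective w ≡ true → Fin n → Fin (suc k)
    insert w _ = punchIn a ∘ lookup w

  count-isInjective : ∀ k → count {k} {k} isInjective ≡ k !
  count-isInjective zero    = refl
  count-isInjective (suc k) =
    count-cons {P = isInjective {suc k} {suc k}} (k !) (λ a → trans (count-isInjective-∷ {n = k} a) (count-isInjective k))

  surjProper≡⇒S≡ : (G : Graph n) (s : ℕ) → surjProper G k ≡ s * k ! → S G k ≡ s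
  surjProper≡⇒S≡ {k = k} G s eq = trans (cong (λ x → (x / k !) {{k !≢0}}) eq) (m*n/n≡m s (k !) {{k !≢0}})

  S-zero : (G : Graph (suc n)) → S G 0 ≡ 0
  S-zero G = refl

  surjProper-≤-precompose : (G H : Graph n) (σ τ : Fin n → Fin n) → (∀ x → σ (τ x) ≡ x) →
    (∀ i j → adj H i j ≡ adj G (σ i) (σ j)) → surjProper G k ≤ surjProper H k
  surjProper-≤-precompose G H σ τ σ∘τ adj-H = count-≤-tabulate (λ c _ → lookup c ∘ σ) exact
    (λ {c} {d} _ _ eq → lookup-≗⇒≡ (λ x → subst (λ y → lookup c y ≡ lookup d y) (σ∘τ x) (eq (τ x))))
    where
    open Equivalence
    exact : ∀ c → (isProper G c ∧ isSurjective c) ≡ true →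
      (isProper H (tabulate (lookup c ∘ σ)) ∧ isSurjective (tabulate (lookup c ∘ σ))) ≡ true
    exact c p with c-proper , c-surj ← to (isExactColouring⇔ G c) p =
      from (isExactColouring⇔ H (tabulate (lookup c ∘ σ)))
      ( proper-tabulate H (λ i j i~j → c-proper (σ i) (σ j) (trans (sym (adj-H i j)) i~j))
      , strictlySurjective-tabulate (strictlySurjective-∘ (λ x → τ x , σ∘τ x) c-surj))

  surjProper-≅ : {G H : Graph n} → G ≅ H → surjProper G k ≡ surjProper H k
  surjProper-≅ {G = G} {H} G≅H = ≤-antisym
    (surjProper-≤-precompose G H from to from∘to
      (λ i j → trans (sym (cong₂ (adj H) (to∘from i) (to∘from j))) (preserve (from i) (from j))))
    (surjProper-≤-precompose H G to from to∘from (λ i j → sym (preserve i j)))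
    where
    open _≅_ G≅H
    open Bijection bij using (to; injective; strictlySurjective)
    from = proj₁ ∘ strictlySurjective
    to∘from : ∀ y → to (from y) ≡ y
    to∘from = proj₂ ∘ strictlySurjective
    from∘to : ∀ x → from (to x) ≡ x
    from∘to x = injective (to∘from (to x))

  exactColouring⇔injective : (G : Graph n) (c : Vec (Fin n) n) → ExactColouring G c ⇔ Injective _≡_ _≡_ (lookup c)
  exactColouring⇔injective G c = mk⇔
    (strictlySurjective⇒injective ∘ proj₂)
    (λ c-inj → injective⇒proper G {c} c-inj , injective⇒strictlySurjective c-inj)

  surjProper-order≡n! : (G : Graph n) → surjProper G n ≡ n !
  surjProper-order≡n! {n} G = trans
    (count-cong (λ c → ⇔-sym (isInjective⇔ c) ⇔-∘ (exactColouring⇔injective G c ⇔-∘ isExactColouring⇔ G c)))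
    (count-isInjective n)

  S-order≡1 : (G : Graph n) → S G n ≡ 1
  S-order≡1 {n} G = surjProper≡⇒S≡ G 1 (trans (surjProper-order≡n! G) (sym (*-identityˡ (n !))))

  -- Permuting the colours of one exact colouring gives k! of them.
  exactColouring⇒k!≤surjProper : (G : Graph n) (c : Vec (Fin k) n) → ExactColouring G c → k ! ≤ surjProper G k
  exactColouring⇒k!≤surjProper {n} {k} G c (c-proper , c-surj) = begin
    k !                        ≡⟨ count-isInjective k ⟨
    count {k} {k} isInjective  ≤⟨ count-≤-tabulate (λ σ _ → lookup σ ∘ lookup c) exact σ∘c-injective ⟩
    surjProper G k             ∎
    where
    open ≤-Reasoning
    open Equivalence
    exact : ∀ σ → isInjective σ ≡ true →
      (isProper G (tabulate (lookup σ ∘ lookup c)) ∧ isSurjective (tabulate (lookup σ ∘ lookup c))) ≡ true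
    exact σ p = from (isExactColouring⇔ G (tabulate (lookup σ ∘ lookup c)))
      ( proper-tabulate G (λ i j i~j → c-proper i j i~j ∘ σ-inj)
      , strictlySurjective-tabulate (strictlySurjective-∘ c-surj (injective⇒strictlySurjective σ-inj)))
      where σ-inj = to (isInjective⇔ σ) p
    σ∘c-injective : ∀ {σ τ} _ _ → lookup σ ∘ lookup c ≗ lookup τ ∘ lookup c → σ ≡ τ
    σ∘c-injective {σ} {τ} _ _ eq = lookup-≗⇒≡ (λ a →
      subst (λ b → lookup σ b ≡ lookup τ b) (proj₂ (c-surj a)) (eq (proj₁ (c-surj a))))

  exactColouring⇒S-pos : (G : Graph n) (c : Vec (Fin k) n) → ExactColouring G c → 1 ≤ S G k
  exactColouring⇒S-pos {k = k} G c c-exact = m≥n⇒m/n>0 {{k !≢0}} (exactColouring⇒k!≤surjProper G c c-exact)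

  -- Partitions into stable sets

  _∈[_,_] : Fin n → Fin n → Fin n → Set
  x ∈[ a , b ] = x ≡ a ⊎ x ≡ b

  _∉[_,_] : Fin n → Fin n → Fin n → Set
  x ∉[ a , b ] = x ≢ a × x ≢ b

  Stable : Graph n → (Fin n → Set) → Set
  Stable G A = ∀ x y → A x → A y → adj G x y ≡ false

  StableFibres : Graph n → (Fin n → Fin k) → Set
  StableFibres G σ = ∀ x y → σ x ≡ σ y → adj G x y ≡ false

  stableFibres⇒S-pos : (G : Graph n) {σ : Fin n → Fin k} →
    StrictlySurjective _≡_ σ → StableFibres G σ → 1 ≤ S G k
  stableFibres⇒S-pos G {σ} σ-surj σ-stable = exactColouring⇒S-pos G (tabulate σ)
    (proper-tabulate G (λ i j i~j σi≡σj → not-¬ (σ-stable i j σi≡σj) i~j) , strictlySurjective-tabulate σ-surj)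

  module _ (G : Graph n) where

    stable-singleton : (a : Fin n) → Stable G (_≡ a)
    stable-singleton a x y refl refl = adj-irrefl G x

    stable-extend : {A : Fin n → Set} {c : Fin n} → Stable G A → (∀ x → A x → adj G x c ≡ false) →
      Stable G (λ x → A x ⊎ x ≡ c)
    stable-extend A-stable c≁A x y (inj₁ Ax)   (inj₁ Ay)   = A-stable x y Ax Ay
    stable-extend A-stable c≁A x y (inj₁ Ax)   (inj₂ refl) = c≁A x Ax
    stable-extend A-stable c≁A x y (inj₂ refl) (inj₁ Ay)   = trans (adj-sym G x y) (c≁A y Ay)
    stable-extend A-stable c≁A x y (inj₂ refl) (inj₂ refl) = adj-irrefl G x

    stable-pair : {a b : Fin n} → adj G a b ≡ false → Stable G (_∈[ a , b ])
    stable-pair {a} a≁b = stable-extend (stable-singleton a) (λ { x refl → a≁b })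

  module _ {a b : Fin (suc k)} (a≢b : a ≢ b) where

    -- Identifies a with b.
    merge : Fin (suc k) → Fin k
    merge x with a Fin.≟ x
    ... | yes _   = punchOut a≢b
    ... | no  a≢x = punchOut a≢x

    merge-≢ : ∀ {x} (a≢x : a ≢ x) → merge x ≡ punchOut a≢x
    merge-≢ {x} a≢x with a Fin.≟ x
    ... | yes a≡x = contradiction a≡x a≢x
    ... | no  _   = punchOut-cong a refl

    merge-surjective : StrictlySurjective _≡_ merge
    merge-surjective y = punchIn a y , trans (merge-≢ (punchInᵢ≢i a y ∘ sym)) (punchOut-punchIn a)

    merge-fibre : ∀ {x y} → merge x ≡ merge y → x ≡ y ⊎ (x ∈[ a , b ] × y ∈[ a , b ])
    merge-fibre {x} {y} eq with a Fin.≟ x | a Fin.≟ y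
    ... | yes refl | yes refl = inj₁ refl
    ... | yes refl | no  a≢y  = inj₂ (inj₁ refl , inj₂ (sym (punchOut-injective a≢b a≢y eq)))
    ... | no  a≢x  | yes refl = inj₂ (inj₂ (punchOut-injective a≢x a≢b eq) , inj₁ refl)
    ... | no  a≢x  | no  a≢y  = inj₁ (punchOut-injective a≢x a≢y eq)

    merge-injective-outside : ∀ {x z} → z ∉[ a , b ] → merge x ≡ merge z → x ≡ z
    merge-injective-outside (z≢a , z≢b) eq with merge-fibre eq
    ... | inj₁ x≡z            = x≡z
    ... | inj₂ (_ , inj₁ z≡a) = contradiction z≡a z≢a
    ... | inj₂ (_ , inj₂ z≡b) = contradiction z≡b z≢b

  merge-stableFibres : (G : Graph n) {σ : Fin n → Fin (suc k)} {p q : Fin (suc k)} (p≢q : p ≢ q) →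
    StableFibres G σ → Stable G (λ x → σ x ∈[ p , q ]) → StableFibres G (merge p≢q ∘ σ)
  merge-stableFibres G p≢q σ-stable pq-stable x y eq with merge-fibre p≢q eq
  ... | inj₁ σx≡σy       = σ-stable x y σx≡σy
  ... | inj₂ (σx∈ , σy∈) = pq-stable x y σx∈ σy∈

  module _ (G : Graph (suc (suc m))) {a b : Fin (suc (suc m))} (a≢b : a ≢ b) (a≁b : adj G a b ≡ false) where

    private
      merge-twice-S-pos : {p q : Fin (suc (suc m))} (σp≢σq : merge a≢b p ≢ merge a≢b q) →
        Stable G (λ x → merge a≢b x ∈[ merge a≢b p , merge a≢b q ]) → 1 ≤ S G m
      merge-twice-S-pos σp≢σq stable = stableFibres⇒S-pos G
        (strictlySurjective-∘ (merge-surjective a≢b) (merge-surjective σp≢σq))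
        (merge-stableFibres G σp≢σq
          (merge-stableFibres G {σ = id} a≢b (λ { x y refl → adj-irrefl G x }) (stable-pair G a≁b))
          stable)

    disjointNonEdges⇒S-pos : {c d : Fin (suc (suc m))} → c ≢ d → adj G c d ≡ false →
      c ∉[ a , b ] → d ∉[ a , b ] → 1 ≤ S G m
    disjointNonEdges⇒S-pos {c} {d} c≢d c≁d c∉ d∉ = merge-twice-S-pos
      (c≢d ∘ merge-injective-outside a≢b d∉)
      (λ x y x∈ y∈ → stable-pair G c≁d x y (back x∈) (back y∈))
      where
      back : ∀ {x} → merge a≢b x ∈[ merge a≢b c , merge a≢b d ] → x ∈[ c , d ]
      back = Sum.map (merge-injective-outside a≢b c∉) (merge-injective-outside a≢b d∉)

    stableTriple⇒S-pos : {c : Fin (suc (suc m))} → c ∉[ a , b ] →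
      adj G a c ≡ false → adj G b c ≡ false → 1 ≤ S G m
    stableTriple⇒S-pos {c} c∉ a≁c b≁c = merge-twice-S-pos
      (λ σa≡σc → proj₁ c∉ (sym (merge-injective-outside a≢b c∉ σa≡σc)))
      (λ x y x∈ y∈ → triple-stable x y (back x∈) (back y∈))
      where
      triple-stable : Stable G (λ x → x ∈[ a , b ] ⊎ x ≡ c)
      triple-stable = stable-extend G (stable-pair G a≁b) (λ { x (inj₁ refl) → a≁c ; x (inj₂ refl) → b≁c })
      back : ∀ {x} → merge a≢b x ∈[ merge a≢b a , merge a≢b c ] → x ∈[ a , b ] ⊎ x ≡ c
      back (inj₁ σx≡σa) with merge-fibre a≢b σx≡σa
      ... | inj₁ x≡a      = inj₁ (inj₁ x≡a)
      ... | inj₂ (x∈ , _) = inj₁ x∈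
      back (inj₂ σx≡σc) = inj₂ (merge-injective-outside a≢b c∉ σx≡σc)

  -- The graph K_{n-1} ∪ K_1

  record CliquePlusIsolated (G : Graph n) (v : Fin n) : Set where
    field
      isolated : ∀ u → adj G v u ≡ false
      clique   : ∀ x y → x ≢ v → y ≢ v → x ≢ y → adj G x y ≡ true

  cliquePlusIsolated-≅ : {G : Graph m} {H : Graph n} (G≅H : G ≅ H) {v : Fin m} →
    CliquePlusIsolated H (Bijection.to (_≅_.bij G≅H) v) → CliquePlusIsolated G v
  cliquePlusIsolated-≅ G≅H {v} H-shape = record
    { isolated = λ u → trans (sym (preserve v u)) (isolated (to u))
    ; clique   = λ x y x≢v y≢v x≢y → trans (sym (preserve x y))
        (clique (to x) (to y) (x≢v ∘ injective) (y≢v ∘ injective) (x≢y ∘ injective))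
    }
    where
    open _≅_ G≅H
    open Bijection bij using (to; injective)
    open CliquePlusIsolated H-shape

  ≅⇒cliquePlusIsolated : {G : Graph m} {H : Graph n} → G ≅ H →
    ∀ {w} → CliquePlusIsolated H w → ∃ (CliquePlusIsolated G)
  ≅⇒cliquePlusIsolated G≅H {w} H-shape with v , to-v≡w ← Bijection.strictlySurjective (_≅_.bij G≅H) w =
    v , cliquePlusIsolated-≅ G≅H (subst (CliquePlusIsolated _) (sym to-v≡w) H-shape)

  cliquePlusIsolated⇒≅ : {G : Graph m} {H : Graph n} (φ : Fin m ⤖ Fin n) {v : Fin m} →
    CliquePlusIsolated G v → CliquePlusIsolated H (Bijection.to φ v) → G ≅ H
  cliquePlusIsolated⇒≅ {G = G} {H} φ {v} G-shape H-shape = record { bij = φ ; preserve = preserve }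
    where
    open Bijection φ using (to; injective)
    module G = CliquePlusIsolated G-shape
    module H = CliquePlusIsolated H-shape
    preserve : ∀ i j → adj H (to i) (to j) ≡ adj G i j
    preserve i j with i Fin.≟ v | j Fin.≟ v | i Fin.≟ j
    ... | yes refl | _        | _        = trans (H.isolated (to j)) (sym (G.isolated j))
    ... | no _     | yes refl | _        =
      trans (adj-sym H _ _) (trans (H.isolated (to i)) (sym (trans (adj-sym G _ _) (G.isolated i))))
    ... | no _     | no _     | yes refl = trans (adj-irrefl H (to i)) (sym (adj-irrefl G i))
    ... | no i≢v   | no j≢v   | no i≢j   =
      trans (H.clique _ _ (i≢v ∘ injective) (j≢v ∘ injective) (i≢j ∘ injective))
            (sym (G.clique i j i≢v j≢v i≢j))

  cliquePlusIsolated-K∪K₁ : CliquePlusIsolated (complete n ∪ complete 1) (n ↑ʳ Fin.zero)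
  cliquePlusIsolated-K∪K₁ {n} = record { isolated = isolated ; clique = clique }
    where
    isolated : ∀ u → adj (complete n ∪ complete 1) (n ↑ʳ Fin.zero) u ≡ false
    isolated u rewrite splitAt-↑ʳ n 1 Fin.zero with splitAt n u
    ... | inj₁ _        = refl
    ... | inj₂ Fin.zero = refl
    clique : ∀ x y → x ≢ n ↑ʳ Fin.zero → y ≢ n ↑ʳ Fin.zero → x ≢ y →
      adj (complete n ∪ complete 1) x y ≡ true
    clique x y x≢ y≢ x≢y with splitAt n x in x≡ | splitAt n y in y≡
    ... | inj₁ p        | inj₁ q        =
      adj-complete (λ p≡q → x≢y (trans (sym (splitAt⁻¹-↑ˡ x≡))
                                     (trans (cong (_↑ˡ 1) p≡q) (splitAt⁻¹-↑ˡ y≡))))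
    ... | inj₂ Fin.zero | _             = contradiction (sym (splitAt⁻¹-↑ʳ x≡)) x≢
    ... | inj₁ _        | inj₂ Fin.zero = contradiction (sym (splitAt⁻¹-↑ʳ y≡)) y≢

  bijection-sending : m ≡ n → (v : Fin m) (w : Fin n) → Σ (Fin m ⤖ Fin n) (λ φ → Bijection.to φ v ≡ w)
  bijection-sending m≡n v w =
    ↔⇒⤖ (cast-id m≡n ∘ₚ transpose (Fin.cast m≡n v) w) , transpose-sends (Fin.cast m≡n v) w
    where
    transpose-sends : ∀ {n} (i j : Fin n) → transpose i j ⟨$⟩ʳ i ≡ j
    transpose-sends i j rewrite dec-true (i Fin.≟ i) refl = refl

  ≅K∪K₁⇔cliquePlusIsolated : (G : Graph (suc (suc m))) →
    G ≅ (complete (suc m) ∪ complete 1) ⇔ ∃ (CliquePlusIsolated G)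
  ≅K∪K₁⇔cliquePlusIsolated {m} G = mk⇔
    (λ G≅K∪K₁ → ≅⇒cliquePlusIsolated G≅K∪K₁ (cliquePlusIsolated-K∪K₁ {suc m}))
    (λ (v , shape) → let φ , φv≡last = bijection-sending (sym (+-comm (suc m) 1)) v (suc m ↑ʳ Fin.zero) in
      cliquePlusIsolated⇒≅ φ shape (subst (CliquePlusIsolated _) (sym φv≡last) cliquePlusIsolated-K∪K₁))

  relabel : Permutation′ n → Graph n → Graph n
  relabel π G = record
    { adj        = λ i j → adj G (π ⟨$⟩ʳ i) (π ⟨$⟩ʳ j)
    ; adj-sym    = λ i j → adj-sym G (π ⟨$⟩ʳ i) (π ⟨$⟩ʳ j)
    ; adj-irrefl = λ i → adj-irrefl G (π ⟨$⟩ʳ i)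
    }

  relabel-≅ : (π : Permutation′ n) (G : Graph n) → relabel π G ≅ G
  relabel-≅ π G = record { bij = ↔⇒⤖ π ; preserve = λ i j → refl }

  module _ {G : Graph (suc m)} (shape : CliquePlusIsolated G Fin.zero) where
    open CliquePlusIsolated shape

    proper-∷⇔injective : (a : Fin k) (w : Vec (Fin k) m) → Proper G (a ∷ᵥ w) ⇔ Injective _≡_ _≡_ (lookup w)
    proper-∷⇔injective a w = mk⇔
      (λ proper {i} {j} wi≡wj → decidable-stable (i Fin.≟ j)
        (λ i≢j → proper (Fin.suc i) (Fin.suc j) (clique _ _ (λ ()) (λ ()) (i≢j ∘ suc-injective)) wi≡wj))
      proper
      where
      proper : Injective _≡_ _≡_ (lookup w) → Proper G (a ∷ᵥ w)
      proper w-inj Fin.zero    j           0~j = contradiction 0~j (not-¬ (isolated j))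
      proper w-inj (Fin.suc i) Fin.zero    i~0 = contradiction (trans (adj-sym G _ _) i~0) (not-¬ (isolated (Fin.suc i)))
      proper w-inj (Fin.suc i) (Fin.suc j) i~j wi≡wj with refl ← w-inj wi≡wj = not-¬ (adj-irrefl G _) i~j

    surjProper-m≡m*m! : surjProper G m ≡ m * m !
    surjProper-m≡m*m! = count-cons (m !) (λ a → trans (count-cong (fibre a)) (count-isInjective m))
      where
      open Equivalence
      fibre : ∀ a (w : Vec (Fin m) m) →
        (isProper G (a ∷ᵥ w) ∧ isSurjective (a ∷ᵥ w)) ≡ true ⇔ isInjective w ≡ true
      fibre a w = mk⇔
        (from (isInjective⇔ w) ∘ to (proper-∷⇔injective a w) ∘ proj₁ ∘ to (isExactColouring⇔ G (a ∷ᵥ w)))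
        (λ p → let w-inj = to (isInjective⇔ w) p in from (isExactColouring⇔ G (a ∷ᵥ w))
          ( from (proper-∷⇔injective a w) w-inj
          , λ b → let i , wi≡b = injective⇒strictlySurjective w-inj b in Fin.suc i , wi≡b))

    surjProper-<m≡0 : k < m → surjProper G k ≡ 0
    surjProper-<m≡0 {k} k<m = count-none {P = λ c → isProper G c ∧ isSurjective c} λ where
      (a ∷ᵥ w) e → <⇒≱ k<m (injective⇒≤ (Equivalence.to (proper-∷⇔injective a w)
        (Equivalence.to (isProper⇔ G (a ∷ᵥ w)) (∧-conicalˡ _ _ e))))

  -- The counting above peels off the first vertex, so the isolated vertex is first moved to position 0.
  module _ {G : Graph (suc m)} {v : Fin (suc m)} (shape : CliquePlusIsolated G v) where

    private
      G₀≅G : relabel (transpose Fin.zero v) G ≅ G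
      G₀≅G = relabel-≅ (transpose Fin.zero v) G
      shape₀ : CliquePlusIsolated (relabel (transpose Fin.zero v) G) Fin.zero
      shape₀ = cliquePlusIsolated-≅ G₀≅G shape

    S-m≡m : S G m ≡ m
    S-m≡m = surjProper≡⇒S≡ {k = m} G m (trans (sym (surjProper-≅ {k = m} G₀≅G)) (surjProper-m≡m*m! shape₀))

    S-<m≡0 : k < m → S G k ≡ 0
    S-<m≡0 {k} k<m =
      surjProper≡⇒S≡ {k = k} G 0 (trans (sym (surjProper-≅ {k = k} G₀≅G)) (surjProper-<m≡0 shape₀ k<m))

  -- Maximum degree n - 2

  ≤-foldr-⊔ : ∀ {x xs} → x ∈ xs → x ≤ foldr _⊔_ 0 xs
  ≤-foldr-⊔ {xs = y ∷ ys} (here refl) = m≤m⊔n y _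
  ≤-foldr-⊔ {xs = y ∷ ys} (there x∈) = ≤-trans (≤-foldr-⊔ x∈) (m≤n⊔m y _)

  degree≤maxDegree : (G : Graph n) (v : Fin n) → degree G v ≤ maxDegree G
  degree≤maxDegree G v = ≤-foldr-⊔ (∈-map⁺ (degree G) (∈-allFin v))

  adjacent-to-all⇒n≤degree : (G : Graph (suc n)) (v : Fin (suc n)) →
    (∀ u → u ≢ v → adj G v u ≡ true) → n ≤ degree G v
  adjacent-to-all⇒n≤degree {n} G v v~all = begin
    n                                    ≡⟨ trans (length-map (punchIn v) (allFin n)) (length-tabulate id) ⟨
    length (map (punchIn v) (allFin n))  ≤⟨ length-≤-injection (Unique.map⁺ (punchIn-injective v _ _) (Unique.allFin⁺ n))
                                              (λ {u} _ → u) neighbour (λ _ _ → id) ⟩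
    degree G v                           ∎
    where
    open ≤-Reasoning
    neighbour : ∀ {u} → u ∈ map (punchIn v) (allFin n) → u ∈ filter (λ u → adj G v u Bool.≟ true) (allFin (suc n))
    neighbour u∈ with i , _ , refl ← ∈-map⁻ (punchIn v) u∈ =
      ∈-filter⁺ (λ u → adj G v u Bool.≟ true) (∈-allFin (punchIn v i)) (v~all _ (punchInᵢ≢i v i))

  non-neighbour : (G : Graph (suc n)) → maxDegree G < n → ∀ v → ∃[ u ] u ≢ v × adj G v u ≡ false
  non-neighbour {n} G Δ<n v with any? (λ u → ¬? (u Fin.≟ v) ×-dec (adj G v u Bool.≟ false))
  ... | yes found = found
  ... | no  none  = contradiction
    (≤-<-trans (adjacent-to-all⇒n≤degree G v v~all) (≤-<-trans (degree≤maxDegree G v) Δ<n)) (<-irrefl refl)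
    where
    v~all : ∀ u → u ≢ v → adj G v u ≡ true
    v~all u u≢v with adj G v u in v≁u
    ... | true  = refl
    ... | false = contradiction (u , u≢v , v≁u) none

  -- Without a partition into m stable sets, any two non-edges of G meet, and the non-edges cover
  -- all vertices; so they form a spanning star, whose centre is isolated in G.
  module _ (G : Graph (suc (suc m))) (¬pos : ¬ 1 ≤ S G m)
           (has-non-neighbour : ∀ v → ∃[ u ] u ≢ v × adj G v u ≡ false) where

    private
      adj-sym-false : ∀ {x y} → adj G x y ≡ false → adj G y x ≡ false
      adj-sym-false {x} {y} x≁y = trans (adj-sym G y x) x≁y

    module _ {p q : Fin (suc (suc m))} (p≢q : p ≢ q) (p≁q : adj G p q ≡ false) where

      outside-adjacent : ∀ {x y} → x ∉[ p , q ] → y ∉[ p , q ] → x ≢ y → adj G x y ≡ true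
      outside-adjacent {x} {y} x∉ y∉ x≢y with adj G x y in x≁y
      ... | true  = refl
      ... | false = contradiction (disjointNonEdges⇒S-pos G p≢q p≁q x≢y x≁y x∉ y∉) ¬pos

      outside-meets : ∀ {w} → w ∉[ p , q ] → adj G p w ≡ false ⊎ adj G q w ≡ false
      outside-meets {w} w∉ with z , z≢w , w≁z ← has-non-neighbour w with z Fin.≟ p | z Fin.≟ q
      ... | yes refl | _        = inj₁ (adj-sym-false w≁z)
      ... | no _     | yes refl = inj₂ (adj-sym-false w≁z)
      ... | no z≢p   | no z≢q   = contradiction (outside-adjacent w∉ (z≢p , z≢q) (z≢w ∘ sym)) (not-¬ w≁z)

      centre : (∀ {w} → w ∉[ p , q ] → adj G q w ≡ true) → CliquePlusIsolated G p
      centre q~outside = record { isolated = isolated ; clique = clique }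
        where
        isolated : ∀ x → adj G p x ≡ false
        isolated x with x Fin.≟ p | x Fin.≟ q
        ... | yes refl | _        = adj-irrefl G p
        ... | no _     | yes refl = p≁q
        ... | no x≢p   | no x≢q   with outside-meets (x≢p , x≢q)
        ...   | inj₁ p≁x = p≁x
        ...   | inj₂ q≁x = contradiction (q~outside (x≢p , x≢q)) (not-¬ q≁x)
        clique : ∀ x y → x ≢ p → y ≢ p → x ≢ y → adj G x y ≡ true
        clique x y x≢p y≢p x≢y with x Fin.≟ q | y Fin.≟ q
        ... | yes refl | _        = q~outside (y≢p , x≢y ∘ sym)
        ... | no x≢q   | yes refl = trans (adj-sym G x q) (q~outside (x≢p , x≢y))
        ... | no x≢q   | no y≢q   = outside-adjacent (x≢p , x≢q) (y≢p , y≢q) x≢y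

    ¬S-pos⇒cliquePlusIsolated : ∃ (CliquePlusIsolated G)
    ¬S-pos⇒cliquePlusIsolated with u , u≢o , o≁u ← has-non-neighbour Fin.zero
      with any? (λ w → (¬? (w Fin.≟ Fin.zero) ×-dec ¬? (w Fin.≟ u)) ×-dec (adj G Fin.zero w Bool.≟ false))
    ... | yes (w , w∉ , o≁w) = Fin.zero , centre (u≢o ∘ sym) o≁u u~outside
      where
      u~outside : ∀ {w′} → w′ ∉[ Fin.zero , u ] → adj G u w′ ≡ true
      u~outside {w′} w′∉ with adj G u w′ in u≁w′ | w′ Fin.≟ w
      ... | true  | _        = refl
      ... | false | yes refl = contradiction (stableTriple⇒S-pos G (u≢o ∘ sym) o≁u w∉ o≁w u≁w′) ¬pos
      ... | false | no w′≢w  = contradiction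
        (disjointNonEdges⇒S-pos G (proj₁ w∉ ∘ sym) o≁w (proj₂ w′∉ ∘ sym) u≁w′
                                  (u≢o , proj₂ w∉ ∘ sym) (proj₁ w′∉ , w′≢w)) ¬pos
    ... | no none = u , centre u≢o (adj-sym-false o≁u) o~outside
      where
      o~outside : ∀ {w} → w ∉[ u , Fin.zero ] → adj G Fin.zero w ≡ true
      o~outside {w} w∉ with adj G Fin.zero w in o≁w
      ... | true  = refl
      ... | false = contradiction (w , swap w∉ , o≁w) none

  cliquePlusIsolated-or-S-pos : (G : Graph (suc (suc m))) → (∀ v → ∃[ u ] u ≢ v × adj G v u ≡ false) →
    1 ≤ S G m ⊎ ∃ (CliquePlusIsolated G)
  cliquePlusIsolated-or-S-pos {m} G has-non-neighbour with 1 ≤? S G m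
  ... | yes pos = inj₁ pos
  ... | no ¬pos = inj₂ (¬S-pos⇒cliquePlusIsolated G ¬pos has-non-neighbour)

  -- The bound

  -- divℚ a (suc b) is fromℚᵘ (mkℚᵘ (+ a) b) by definition, so the comparison can be made in ℚᵘ.
  divℚ-< : ∀ {a b c d} → 1 ≤ b → 1 ≤ d → a * d < c * b → divℚ a b ℚ.< divℚ c d
  divℚ-< {a} {suc b} {c} {suc d} _ _ ad<cb = ℚ.toℚᵘ-cancel-<
    (<-respˡ-≃ (≃-sym (ℚ.toℚᵘ-fromℚᵘ (mkℚᵘ (ℤ.+ a) b)))
      (<-respʳ-≃ (≃-sym (ℚ.toℚᵘ-fromℚᵘ (mkℚᵘ (ℤ.+ c) d)))
        (*<* (subst₂ ℤ._<_ (pos-* a (suc d)) (pos-* c (suc b)) (ℤ.+<+ ad<cb)))))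

  sumFrom1-≡0 : ∀ (f : ℕ → ℕ) m → (∀ k → k ≤ m → f k ≡ 0) → sumFrom1 m f ≡ 0
  sumFrom1-≡0 f zero    f≡0 = refl
  sumFrom1-≡0 f (suc m) f≡0 = cong₂ _+_ (sumFrom1-≡0 f m (λ k → f≡0 k ∘ m≤n⇒m≤1+n)) (f≡0 (suc m) ≤-refl)

  sumFrom1-weighted-≤ : ∀ (f : ℕ → ℕ) m → sumFrom1 m (λ k → k * f k) ≤ m * sumFrom1 m f
  sumFrom1-weighted-≤ f zero    = z≤n
  sumFrom1-weighted-≤ f (suc m) = begin
    sumFrom1 m (λ k → k * f k) + suc m * f (suc m)  ≤⟨ +-monoˡ-≤ _ (sumFrom1-weighted-≤ f m) ⟩
    m * sumFrom1 m f + suc m * f (suc m)            ≤⟨ +-monoˡ-≤ _ (*-monoˡ-≤ (sumFrom1 m f) (n≤1+n m)) ⟩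
    suc m * sumFrom1 m f + suc m * f (suc m)        ≡⟨ *-distribˡ-+ (suc m) (sumFrom1 m f) (f (suc m)) ⟨
    suc m * (sumFrom1 m f + f (suc m))              ∎
    where open ≤-Reasoning

  S-pos⇒sumFrom1-pos : (G : Graph (suc n)) → 1 ≤ S G m → 1 ≤ sumFrom1 m (S G)
  S-pos⇒sumFrom1-pos {m = zero}  G pos = contradiction (subst (1 ≤_) (S-zero G) pos) (λ ())
  S-pos⇒sumFrom1-pos {m = suc m} G pos = ≤-trans pos (m≤n+m (S G (suc m)) (sumFrom1 m (S G)))

  n*n∸n+1≡pred[n]*n+1 : ∀ m → (2 + m) * (2 + m) ∸ (2 + m) + 1 ≡ suc m * (2 + m) + 1
  n*n∸n+1≡pred[n]*n+1 m = cong (_+ 1) (m+n∸m≡n (2 + m) (suc m * (2 + m)))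

  -- The cross-multiplied form of 𝓐 < (n²-n+1)/n: with T ≤ mB, the slack is (n+1)B + s + 1 - n ≥ 2.
  cross-multiplied-bound : ∀ m B T s → 1 ≤ B → T ≤ m * B →
    ((T + suc m * s) + (2 + m) * 1) * (2 + m) < (suc m * (2 + m) + 1) * ((B + s) + 1)
  cross-multiplied-bound m (suc b) T s _ T≤mB = begin-strict
    ((T + suc m * s) + (2 + m) * 1) * (2 + m)
      ≤⟨ *-monoˡ-≤ (2 + m) (+-monoˡ-≤ _ (+-monoˡ-≤ _ T≤mB)) ⟩
    ((m * suc b + suc m * s) + (2 + m) * 1) * (2 + m)
      <⟨ m<m+n _ (s≤s z≤n) ⟩
    ((m * suc b + suc m * s) + (2 + m) * 1) * (2 + m) + (2 + (2 + m) * b + b + s)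
      ≡⟨ identity m b s ⟩
    (suc m * (2 + m) + 1) * ((suc b + s) + 1) ∎
    where
    open ≤-Reasoning
    identity : ∀ m b s → ((m * suc b + suc m * s) + (2 + m) * 1) * (2 + m) + (2 + (2 + m) * b + b + s)
                       ≡ (suc m * (2 + m) + 1) * ((suc b + s) + 1)
    identity = solve-∀

  𝓐<bound : (G : Graph (suc (suc m))) → 1 ≤ S G m → 𝓐 G ℚ.< divℚ ((2 + m) * (2 + m) ∸ (2 + m) + 1) (2 + m)
  𝓐<bound {m} G pos = divℚ-< {c = (2 + m) * (2 + m) ∸ (2 + m) + 1} 1≤𝓑 (s≤s z≤n) (begin-strict
    𝓣 G * (2 + m)
      ≡⟨ cong (λ x → ((T + suc m * s) + (2 + m) * x) * (2 + m)) (S-order≡1 G) ⟩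
    ((T + suc m * s) + (2 + m) * 1) * (2 + m)
      <⟨ cross-multiplied-bound m B T s 1≤B (sumFrom1-weighted-≤ (S G) m) ⟩
    (suc m * (2 + m) + 1) * ((B + s) + 1)
      ≡⟨ cong₂ _*_ (n*n∸n+1≡pred[n]*n+1 m) (cong ((B + s) +_) (S-order≡1 G)) ⟨
    ((2 + m) * (2 + m) ∸ (2 + m) + 1) * 𝓑 G ∎)
    where
    open ≤-Reasoning
    B = sumFrom1 m (S G)
    T = sumFrom1 m (λ k → k * S G k)
    s = S G (suc m)
    1≤B : 1 ≤ B
    1≤B = S-pos⇒sumFrom1-pos {m = m} G pos
    1≤𝓑 : 1 ≤ 𝓑 G
    1≤𝓑 = ≤-trans 1≤B (≤-trans (m≤m+n B s) (m≤m+n (B + s) _))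

  𝓐-cliquePlusIsolated : {G : Graph (suc (suc m))} {v : Fin (suc (suc m))} → CliquePlusIsolated G v →
    𝓐 G ≡ divℚ ((2 + m) * (2 + m) ∸ (2 + m) + 1) (2 + m)
  𝓐-cliquePlusIsolated {m} {G} shape = cong₂ divℚ 𝓣≡ 𝓑≡
    where
    open ≡-Reasoning
    vanishes : ∀ k → k ≤ m → S G k ≡ 0
    vanishes k k≤m = S-<m≡0 shape (s≤s k≤m)
    𝓑≡ : 𝓑 G ≡ 2 + m
    𝓑≡ = begin
      (sumFrom1 m (S G) + S G (suc m)) + S G (2 + m)
        ≡⟨ cong₂ _+_ (cong₂ _+_ (sumFrom1-≡0 (S G) m vanishes) (S-m≡m shape)) (S-order≡1 G) ⟩
      suc m + 1
        ≡⟨ +-comm (suc m) 1 ⟩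
      2 + m ∎
    𝓣≡ : 𝓣 G ≡ (2 + m) * (2 + m) ∸ (2 + m) + 1
    𝓣≡ = begin
      (sumFrom1 m (λ k → k * S G k) + suc m * S G (suc m)) + (2 + m) * S G (2 + m)
        ≡⟨ cong₂ _+_ (cong₂ _+_ (sumFrom1-≡0 _ m (λ k k≤m → trans (cong (k *_) (vanishes k k≤m)) (*-zeroʳ k)))
                                (cong (suc m *_) (S-m≡m shape)))
                     (cong ((2 + m) *_) (S-order≡1 G)) ⟩
      suc m * suc m + (2 + m) * 1
        ≡⟨ identity m ⟩
      suc m * (2 + m) + 1
        ≡⟨ n*n∸n+1≡pred[n]*n+1 m ⟨
      (2 + m) * (2 + m) ∸ (2 + m) + 1 ∎
      where
      identity : ∀ m → suc m * suc m + (2 + m) * 1 ≡ suc m * (2 + m) + 1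
      identity = solve-∀

open StableSetPartitions
open import Data.Nat using (ℕ; suc; _≥_; _∸_; _*_; _+_; s≤s; z≤n)
open import Data.Nat.Properties using (≤-reflexive)
open import Data.Rational using (_≤_)
import Data.Rational.Properties as ℚ
open import Data.Product using (_×_; _,_)
open import Data.Sum using (inj₁; inj₂)
open import Function.Bundles using (_⇔_; mk⇔; Equivalence)
open import Relation.Binary.PropositionalEquality using (_≡_; cong)
open import Relation.Nullary using (contradiction)

theorem12 : (n : ℕ) → (n≥2 : n ≥ 2) → (G : Graph n) → maxDegree G ≡ n ∸ 2 →
    (𝓐 G ≤ divℚ (n * n ∸ n + 1) n)
    × (𝓐 G ≡ divℚ (n * n ∸ n + 1) n ⇔ G ≅ (complete (n ∸ 1) ∪ complete 1))
theorem12 (suc (suc m)) (s≤s (s≤s z≤n)) G Δ≡m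
  with cliquePlusIsolated-or-S-pos G (non-neighbour G (≤-reflexive (cong suc Δ≡m)))
... | inj₁ pos = ℚ.<⇒≤ 𝓐< , mk⇔
  (λ 𝓐≡ → contradiction 𝓐≡ (ℚ.<⇒≢ 𝓐<))
  (λ G≅K∪K₁ → let _ , shape = Equivalence.to (≅K∪K₁⇔cliquePlusIsolated G) G≅K∪K₁ in
    contradiction (𝓐-cliquePlusIsolated shape) (ℚ.<⇒≢ 𝓐<))
  where 𝓐< = 𝓐<bound G pos
... | inj₂ (v , shape) = ℚ.≤-reflexive (𝓐-cliquePlusIsolated shape) , mk⇔
  (λ _ → Equivalence.from (≅K∪K₁⇔cliquePlusIsolated G) (v , shape))
  (λ _ → 𝓐-cliquePlusIsolated shape)
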